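{- Fix a sort $\rho\colon d\to k^{\mathsf{u}}$. Let $\mathcal{A}\in P(\rho)$, and let $\gamma = (\rho, \eta, \mathbf{J})$ be a reasonable gluing. Then $\mathcal{A}\cap \mathcal{K}(\gamma)\in P(\rho)$.
   Context: Setting: $\mathcal{L} = \{U_i: i< k^{\mathsf{u}}\}\cup \{R_i: i< k\}$ is a finite language with each $U_i$ unary and each $R_i$ binary; every $\mathcal{L}$-structure considered has each point in exactly one $U_i$, no $R_i(a,a)$, each pair of distinct points in exactly one $R_i$, and there is an order-2 bijection $\mathrm{Flip}$ of $k$ with $\mathrm{Flip}(0)=0$ such that $R_i(a,b)$ iff $R_{\mathrm{Flip}(i)}(b,a)$; $R_0$ plays the role of "no relation" (this is the sense of "irreducible" and "free amalgam"). $\mathcal{F}$ is a finite set of finite irreducible $\mathcal{L}$-structures (pairwise non-embeddable, each of size $\ge 2$), and $\mathcal{K} = \mathrm{Forb}(\mathcal{F})$ is the class of finite $\mathcal{L}$-structures into which no member of $\mathcal{F}$ embeds. It is assumed that every unary $i<k^{\mathsf{u}}$ is non-degenerate (some two-element structure in $\mathcal{K}$ has a point with unary $i$ and a nonzero binary relation between its two points). $\mathbf{K}$ is a fixed enumerated (underlying set $\omega$), left-dense Fraïssé limit of $\mathcal{K}$. Tree: $T = k^{\mathsf{u}}\times k^{<\omega}$; for $t = (t^{\mathsf{u}}, t^{\mathsf{b}})$, $\ell(t) = \mathrm{dom}(t^{\mathsf{b}})$, $T(n) = \{t: \ell(t) = n\}$, ordered lexicographically ($\preceq_{lex}$, first by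 $t^{\mathsf{u}}$). The coding function $c\colon \mathbf{K}\to T$ sends $n$ to $c(n)\in T(n)$ with $c(n)^{\mathsf{u}} = U^{\mathbf{K}}(n)$ and $c(n)^{\mathsf{b}}(m) = R^{\mathbf{K}}(n,m)$ for $m<n$; $\mathrm{CT} = \{t\in T: t\sqsubseteq c(a)\text{ for some } a\in\mathbf{K}\}$ and $\mathrm{CT}(n) = \mathrm{CT}\cap T(n)$. $\mathcal{L}_d$-structures: $\mathcal{L}_d$ consists of the binary symbols of $\mathcal{L}$ together with new unaries $V_0,\dots,V_{d-1}$, each point lying in exactly one $V_i$ (write $V^{\mathbf{B}}(x)=i$); underlying sets are disjoint from $\omega$. Gluings: a gluing is a triple $\gamma = (\rho,\eta,\mathbf{I})$ where $\rho\colon d\to k^{\mathsf{u}}$ (the sort, of rank $d$), $\eta\colon d\times n\to k$, and $\mathbf{I}\in\mathcal{K}$ is an enumerated structure on $n$. For an $\mathcal{L}_d$-structure $\mathbf{B}$, $\mathbf{B}[\gamma]$ is the $\mathcal{L}$-structure on $n\cup B$ with $\mathbf{I}$ on $n$, the binary part of $\mathbf{B}$ on $B$, $U(b) = \rho(V^{\mathbf{B}}(b))$ for $b\in B$, and $R(b,x) = \eta(V^{\mathbf{B}}(b), x)$ for $b\in B$, $x\in \mathbf{I}$. If $n=0$, write $\mathbf{B}[\rho]$. The age of $\gamma$ is $\mathcal{K}(\gamma) = \{\mathbf{B}: \mathbf{B}[\gamma]\in\mathcal{K}\}$, and $\mathcal{K}(\rho) = \{\mathbf{B}: \mathbf{B}[\rho]\in\mathcal{K}\}$.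 For $S = \{s_0\preceq_{lex}\cdots\preceq_{lex}s_{d-1}\}\subseteq T(n)$, $S^{\mathsf{u}}(i) = s_i^{\mathsf{u}}$, $S^{\mathsf{b}}(i,m) = s_i^{\mathsf{b}}(m)$, and $\mathcal{K}(S) = \mathcal{K}((S^{\mathsf{u}}, S^{\mathsf{b}}, \mathbf{K}_n))$ where $\mathbf{K}_n = \mathbf{K}\cap n$. A gluing is reasonable if $\mathcal{K}(\gamma)$ contains every singleton $\mathcal{L}_d$-structure. Poset of ages: for a (non-decreasing) sort $\rho\colon d\to k^{\mathsf{u}}$, $P(\rho) = \{\mathcal{K}(S): S\subseteq\mathrm{CT}(n)\text{ for some } n \text{ and } S^{\mathsf{u}} = \rho\}$, ordered by inclusion. -}

module Defs where

open import Data.Nat using (ℕ; zero; suc; _+_) renaming (_≤_ to _≤ℕ_)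
open import Data.Fin using (Fin; toℕ; splitAt) renaming (zero to fzero; suc to fsuc; _<_ to _<ᶠ_)
open import Data.Product using (Σ; Σ-syntax; ∃; _×_; _,_)
open import Data.Sum using (_⊎_; inj₁; inj₂)
open import Relation.Nullary using (¬_)
open import Relation.Binary.PropositionalEquality using (_≡_; _≢_)
open import Function.Definitions using (Injective)
open import Function.Bundles using (_⇔_)

-- The language L: k^u unary symbols U_i (i < ku) and k binary symbols
-- R_i (i < k), where k = suc k₀ (so that R_0, "no relation", exists),
-- together with the map Flip on binary indices.

module Lang (ku k₀ : ℕ) (Flip : Fin (suc k₀) → Fin (suc k₀)) where

  k : ℕ
  k = suc k₀

  -- Each point has
  -- exactly one unary (U), each pair of distinct points exactly one binary
  -- relation (R a b = i means R_i(a,b)).  The diagonal value R a a is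
  -- meaningless ("no R_i(a,a)") and is ignored everywhere.
  record Str (n : ℕ) : Set where
    field
      U : Fin n → Fin ku
      R : Fin n → Fin n → Fin k
  open Str public

  WF : ∀ {n} → Str n → Set
  WF A = ∀ a b → a ≢ b → R A b a ≡ Flip (R A a b)

  IsEmb : ∀ {m n} → Str m → Str n → (Fin m → Fin n) → Set
  IsEmb A B f = Injective _≡_ _≡_ f
              × (∀ a → U B (f a) ≡ U A a)
              × (∀ a b → a ≢ b → R B (f a) (f b) ≡ R A a b)

  Embeds : ∀ {m n} → Str m → Str n → Set
  Embeds A B = Σ[ f ∈ _ ] IsEmb A B f

  Irreducible : ∀ {n} → Str n → Set
  Irreducible A = ∀ a b → a ≢ b → R A a b ≢ fzero

  record LdStr (d m : ℕ) : Set where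
    field
      V  : Fin m → Fin d
      Rd : Fin m → Fin m → Fin k
  open LdStr public

  Cls : ℕ → Set₁
  Cls d = ∀ m → LdStr d m → Set

  _∩_ : ∀ {d} → Cls d → Cls d → Cls d
  (𝒜 ∩ ℬ) m B = 𝒜 m B × ℬ m B

  -- B[γ] for γ = (ρ, η, I): the L-structure on n ∪ B (coded as Fin (n + m),
  -- the first n points being I).  R(x,b) for x ∈ I, b ∈ B is forced by the
  -- Flip axiom from R(b,x) = η(V b, x).
  glue : ∀ {d n m} → (Fin d → Fin ku) → (Fin d → Fin n → Fin k) → Str n
       → LdStr d m → Str (n + m)
  glue {n = n} ρ η I B = record { U = u ; R = r }
    where
      u : Fin (n + _) → Fin ku
      u i with splitAt n i
      ... | inj₁ x = U I x
      ... | inj₂ b = ρ (V B b)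
      r : Fin (n + _) → Fin (n + _) → Fin k
      r i j with splitAt n i | splitAt n j
      ... | inj₁ x | inj₁ y = R I x y
      ... | inj₂ b | inj₂ c = Rd B b c
      ... | inj₂ b | inj₁ x = η (V B b) x
      ... | inj₁ x | inj₂ b = Flip (η (V B b) x)

  record KStr : Set where
    field
      UK : ℕ → Fin ku
      RK : ℕ → ℕ → Fin k
  open KStr public

  WFK : KStr → Set
  WFK K = ∀ a b → a ≢ b → RK K b a ≡ Flip (RK K a b)

  IsEmbK : ∀ {m} → Str m → KStr → (Fin m → ℕ) → Set
  IsEmbK A K f = Injective _≡_ _≡_ f
               × (∀ a → UK K (f a) ≡ U A a)
               × (∀ a b → a ≢ b → RK K (f a) (f b) ≡ R A a b)

  EmbedsK : ∀ {m} → Str m → KStr → Set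
  EmbedsK A K = Σ[ f ∈ _ ] IsEmbK A K f

  IsAut : KStr → (ℕ → ℕ) → (ℕ → ℕ) → Set
  IsAut K σ τ = (∀ x → τ (σ x) ≡ x) × (∀ x → σ (τ x) ≡ x)
              × (∀ x → UK K (σ x) ≡ UK K x)
              × (∀ x y → x ≢ y → RK K (σ x) (σ y) ≡ RK K x y)

  -- ultrahomogeneity: every isomorphism between finite substructures
  -- (given by two injective enumerations inducing the same structure)
  -- extends to an automorphism
  Ultrahomogeneous : KStr → Set
  Ultrahomogeneous K =
    ∀ m (e₁ e₂ : Fin m → ℕ) → Injective _≡_ _≡_ e₁ → Injective _≡_ _≡_ e₂
    → (∀ i → UK K (e₁ i) ≡ UK K (e₂ i))
    → (∀ i j → i ≢ j → RK K (e₁ i) (e₁ j) ≡ RK K (e₂ i) (e₂ j))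
    → Σ[ σ ∈ (ℕ → ℕ) ] Σ[ τ ∈ (ℕ → ℕ) ] IsAut K σ τ × (∀ i → σ (e₁ i) ≡ e₂ i)

  initial : KStr → (n : ℕ) → Str n
  initial K n = record { U = λ i → UK K (toℕ i) ; R = λ i j → RK K (toℕ i) (toℕ j) }

  -- The tree T = k^u × k^{<ω}; nodes of length n
  record Node (n : ℕ) : Set where
    field
      nu : Fin ku
      nb : Fin n → Fin k
  open Node public

  -- t ∈ CT(n): t ⊑ c(a) for some a ∈ K (necessarily n ≤ a)
  InCT : KStr → ∀ {n} → Node n → Set
  InCT K {n} t = Σ[ a ∈ ℕ ] n ≤ℕ a × UK K a ≡ nu t
                   × (∀ (m : Fin n) → RK K a (toℕ m) ≡ nb t m)

  _<lex_ : ∀ {n} → Node n → Node n → Set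
  s <lex t = nu s <ᶠ nu t
           ⊎ (nu s ≡ nu t × Σ[ m ∈ Fin _ ]
                ((∀ j → j <ᶠ m → nb s j ≡ nb t j) × nb s m <ᶠ nb t m))

  module Forb (nF : ℕ) (𝓕 : Fin nF → Σ ℕ Str) where

    In𝒦 : ∀ {n} → Str n → Set
    In𝒦 A = WF A × (∀ (i : Fin nF) → let (_ , F) = 𝓕 i in ¬ Embeds F A)

    ForbHyps : Set
    ForbHyps = (∀ i → let (s , F) = 𝓕 i in WF F × Irreducible F × 2 ≤ℕ s)
             × (∀ i j → i ≢ j → let (_ , F) = 𝓕 i ; (_ , G) = 𝓕 j in ¬ Embeds F G)

    NonDegenerate : Set
    NonDegenerate = ∀ (i : Fin ku) → Σ[ A ∈ Str 2 ] In𝒦 A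
                      × (Σ[ a ∈ Fin 2 ] U A a ≡ i)
                      × R A fzero (fsuc fzero) ≢ fzero

    FraisseLimit : KStr → Set
    FraisseLimit K = WFK K
                   × (∀ n (A : Str n) → In𝒦 A ⇔ EmbedsK A K)
                   × Ultrahomogeneous K

    Age : ∀ {d n} → (Fin d → Fin ku) → (Fin d → Fin n → Fin k) → Str n → Cls d
    Age ρ η I m B = In𝒦 (glue ρ η I B)

    Reasonable : ∀ {d n} → (Fin d → Fin ku) → (Fin d → Fin n → Fin k) → Str n → Set
    Reasonable ρ η I = ∀ (B : LdStr _ 1) → Age ρ η I 1 B

    AgeS : KStr → ∀ {d n} → (Fin d → Node n) → Cls d
    AgeS K {n = n} S = Age (λ i → nu (S i)) (λ i m → nb (S i) m) (initial K n)

    InP : KStr → ∀ {d} → (Fin d → Fin ku) → Cls d → Set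
    InP K {d} ρ 𝒜 =
      Σ[ n ∈ ℕ ] Σ[ S ∈ (Fin d → Node n) ]
        (∀ i → InCT K (S i))
        × (∀ i j → i <ᶠ j → S i <lex S j)
        × (∀ i → nu (S i) ≡ ρ i)
        × (∀ m B → 𝒜 m B ⇔ AgeS K S m B)

{-# OPTIONS --safe #-}
-- Write 𝒜 = 𝒦(S) with S ⊆ CT(n). The free amalgam of K ∩ n and J lies in 𝒦, so by
-- ultrahomogeneity K contains a copy h(J) of J above n with no relations to K ∩ n.
-- Extend every node of S to a level N above h(J), by η on h(J) and by R₀ elsewhere.
-- Then B[S′] is covered by K ∩ N, B[S] and B[γ], and every pair of points not in a
-- common part is in R₀; as forbidden structures are irreducible, B[S′] ∈ 𝒦 iff
-- B[S] ∈ 𝒦 and B[γ] ∈ 𝒦, i.e. 𝒦(S′) = 𝒜 ∩ 𝒦(γ). Since γ is reasonable, each extended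
-- node is realised in K, so S′ ⊆ CT(N); it is still sorted because it extends S.
module Submission where

open import Defs
open import Data.Nat using (ℕ; suc; s≤s; _<_; _≤_; _<?_) renaming (_≟_ to _≟ℕ_)
open import Data.Nat.Properties using (<-≤-trans; <⇒≤; <⇒≢; ≮⇒≥; m≤n⇒m≤1+n)
open import Data.Fin using (Fin; toℕ; fromℕ<; inject≤; splitAt; join; _≟_) renaming (zero to fzero; _<_ to _<ᶠ_)
open import Data.Fin.Properties using (toℕ-injective; toℕ-fromℕ<; toℕ-inject≤; toℕ<n; splitAt-join; join-splitAt; any?)
open import Data.List using (map; allFin)
open import Data.List.Extrema.Nat using (max; ⊥≤max; xs≤max)
open import Data.List.Membership.Propositional.Properties using (∈-map⁺; ∈-allFin)
import Data.List.Relation.Unary.All as All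
open import Data.Product using (Σ; ∃; _×_; _,_; proj₁; proj₂)
open import Data.Product.Function.NonDependent.Propositional using (_×-⇔_)
open import Data.Sum using (_⊎_; inj₁; inj₂) renaming (map to map⊎)
open import Data.Sum.Properties using (inj₁-injective; inj₂-injective; ≡-dec)
open import Data.Empty using (⊥; ⊥-elim)
open import Function using (_∘_; id)
open import Function.Bundles using (_⇔_; mk⇔; Equivalence)
open import Function.Definitions using (Injective)
import Function.Properties.Equivalence as ⇔
open import Relation.Nullary using (¬_; yes; no)
open import Relation.Nullary.Decidable using (¬?; _⊎-dec_; map′; decidable-stable)
open import Relation.Binary.Definitions using (DecidableEquality)
open import Relation.Unary using (Decidable)
open import Relation.Binary.PropositionalEquality
  using (_≡_; _≢_; refl; sym; trans; cong; cong₂; subst₂; module ≡-Reasoning)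

retraction⇒injective : ∀ {X Y : Set} {f : X → Y} (g : Y → X) → (∀ x → g (f x) ≡ x)
                     → Injective _≡_ _≡_ f
retraction⇒injective {f = f} g gf {x} {y} fx≡fy = trans (sym (gf x)) (trans (cong g fx≡fy) (gf y))

Image : ∀ {X Y : Set} → (X → Y) → Y → Set
Image f y = ∃ λ x → f x ≡ y

image? : ∀ {n} {Y : Set} → DecidableEquality Y → (f : Fin n → Y) → Decidable (Image f)
image? _≟Y_ f y = any? (λ x → f x ≟Y y)

image⊎? : ∀ {n m} {Y : Set} → DecidableEquality Y → (f : Fin n ⊎ Fin m → Y) → Decidable (Image f)
image⊎? _≟Y_ f y = map′ fromSides toSides (image? _≟Y_ (f ∘ inj₁) y ⊎-dec image? _≟Y_ (f ∘ inj₂) y)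
  where
    fromSides : Image (f ∘ inj₁) y ⊎ Image (f ∘ inj₂) y → Image f y
    fromSides (inj₁ (x , fx≡y)) = inj₁ x , fx≡y
    fromSides (inj₂ (b , fb≡y)) = inj₂ b , fb≡y
    toSides : Image f y → Image (f ∘ inj₁) y ⊎ Image (f ∘ inj₂) y
    toSides (inj₁ x , fx≡y) = inj₁ (x , fx≡y)
    toSides (inj₂ b , fb≡y) = inj₂ (b , fb≡y)

module Development (ku k₀ : ℕ) (Flip : Fin (suc k₀) → Fin (suc k₀))
                   (Flip-0 : Flip fzero ≡ fzero) (Flip-involutive : ∀ i → Flip (Flip i) ≡ i)
                   (nF : ℕ) (𝓕 : Fin nF → Σ ℕ (Lang.Str ku k₀ Flip)) where
  open Lang ku k₀ Flip
  open Forb nF 𝓕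

  -- Structures on an arbitrary carrier, so that B[γ] can live on I ⊎ B and K on ℕ.
  record Structure (X : Set) : Set where
    field
      u : X → Fin ku
      r : X → X → Fin k
  open Structure

  toStructure : ∀ {n} → Str n → Structure (Fin n)
  toStructure A = record { u = U A ; r = R A }

  record IsEmbedding {X Y} (A : Structure X) (C : Structure Y) (f : X → Y) : Set where
    constructor isEmbedding
    field
      injective   : Injective _≡_ _≡_ f
      preserves-u : ∀ a → u C (f a) ≡ u A a
      preserves-r : ∀ a b → a ≢ b → r C (f a) (f b) ≡ r A a b
  open IsEmbedding

  -- Defs' IsEmb and IsEmbK unfold to this.
  EmbeddingTriple : ∀ {X Y} → Structure X → Structure Y → (X → Y) → Set
  EmbeddingTriple A C f = Injective _≡_ _≡_ f
                        × (∀ a → u C (f a) ≡ u A a)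
                        × (∀ a b → a ≢ b → r C (f a) (f b) ≡ r A a b)

  fromTriple : ∀ {X Y} {A : Structure X} {C : Structure Y} {f} → EmbeddingTriple A C f → IsEmbedding A C f
  fromTriple (f-inj , f-u , f-r) = isEmbedding f-inj f-u f-r

  toTriple : ∀ {X Y} {A : Structure X} {C : Structure Y} {f} → IsEmbedding A C f → EmbeddingTriple A C f
  toTriple (isEmbedding f-inj f-u f-r) = f-inj , f-u , f-r

  ∘-isEmbedding : ∀ {X Y Z} {A : Structure X} {B : Structure Y} {C : Structure Z} {f g}
                → IsEmbedding B C g → IsEmbedding A B f → IsEmbedding A C (g ∘ f)
  ∘-isEmbedding {f = f} (isEmbedding g-inj g-u g-r) (isEmbedding f-inj f-u f-r) = isEmbedding
    (f-inj ∘ g-inj)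
    (λ a → trans (g-u (f a)) (f-u a))
    (λ a b a≢b → trans (g-r (f a) (f b) (a≢b ∘ f-inj)) (f-r a b a≢b))

  WellFormed : ∀ {X} → Structure X → Set
  WellFormed C = ∀ a b → a ≢ b → r C b a ≡ Flip (r C a b)

  forbidden : (i : Fin nF) → Structure (Fin (proj₁ (𝓕 i)))
  forbidden i = toStructure (proj₂ (𝓕 i))

  𝒦Free : ∀ {X} → Structure X → Set
  𝒦Free C = ∀ i → ¬ ∃ (IsEmbedding (forbidden i) C)

  In𝒦ˣ : ∀ {X} → Structure X → Set
  In𝒦ˣ C = WellFormed C × 𝒦Free C

  wellFormed-pullback : ∀ {X Y} {A : Structure X} {C : Structure Y} {f}
                      → IsEmbedding A C f → WellFormed C → WellFormed A
  wellFormed-pullback {A = A} {C} {f} (isEmbedding f-inj _ f-r) wf a b a≢b = begin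
    r A b a                ≡⟨ f-r b a (a≢b ∘ sym) ⟨
    r C (f b) (f a)        ≡⟨ wf (f a) (f b) (a≢b ∘ f-inj) ⟩
    Flip (r C (f a) (f b)) ≡⟨ cong Flip (f-r a b a≢b) ⟩
    Flip (r A a b)         ∎
    where open ≡-Reasoning

  in𝒦-pullback : ∀ {X Y} {A : Structure X} {C : Structure Y} {f}
               → IsEmbedding A C f → In𝒦ˣ C → In𝒦ˣ A
  in𝒦-pullback {f = f} f-emb (wf , free) =
    wellFormed-pullback f-emb wf , λ i (e , e-emb) → free i (f ∘ e , ∘-isEmbedding f-emb e-emb)

  in𝒦⇔ : ∀ {n} (A : Str n) → In𝒦 A ⇔ In𝒦ˣ (toStructure A)
  in𝒦⇔ A = mk⇔
    (λ (wf , free) → wf , λ i (e , e-emb) → free i (e , toTriple e-emb))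
    (λ (wf , free) → wf , λ i (e , e-emb) → free i (e , fromTriple e-emb))

  ForbidsOn : ∀ {X} → Structure X → (X → Set) → Set
  ForbidsOn C P = ∀ i e → IsEmbedding (forbidden i) C e → (∀ a → P (e a)) → ⊥

  forbidsOn-image : ∀ {X Y} {A : Structure X} {C : Structure Y} {φ}
                  → IsEmbedding A C φ → 𝒦Free A → ForbidsOn C (Image φ)
  forbidsOn-image {X} {A = A} {C} {φ} (isEmbedding φ-inj φ-u φ-r) free i e (isEmbedding e-inj e-u e-r) e∈φ =
    free i (g , isEmbedding g-inj g-u g-r)
    where
      g : Fin (proj₁ (𝓕 i)) → X
      g a = proj₁ (e∈φ a)
      φg : ∀ a → φ (g a) ≡ e a
      φg a = proj₂ (e∈φ a)
      g-inj : Injective _≡_ _≡_ g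
      g-inj {a} {b} ga≡gb = e-inj (trans (sym (φg a)) (trans (cong φ ga≡gb) (φg b)))
      g-u : ∀ a → u A (g a) ≡ u (forbidden i) a
      g-u a = trans (sym (φ-u (g a))) (trans (cong (u C) (φg a)) (e-u a))
      g-r : ∀ a b → a ≢ b → r A (g a) (g b) ≡ r (forbidden i) a b
      g-r a b a≢b = trans (sym (φ-r (g a) (g b) (a≢b ∘ g-inj)))
                          (trans (cong₂ (r C) (φg a) (φg b)) (e-r a b a≢b))

  𝒦Free-from-forbidsOn : ∀ {X} {C : Structure X} {P} → ForbidsOn C P → (∀ x → P x) → 𝒦Free C
  𝒦Free-from-forbidsOn forbids everywhere i (e , e-emb) = forbids i e e-emb (everywhere ∘ e)

  -- Free amalgamation: an irreducible structure meeting P∖Q and Q∖P would relate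
  -- two such points by R₀, so it lies entirely inside P or inside Q.
  forbidsOn-∪ : ∀ {X} {C : Structure X} {P Q : X → Set}
              → (∀ i → Irreducible (proj₂ (𝓕 i)))
              → ForbidsOn C P → ForbidsOn C Q → Decidable P → Decidable Q
              → (∀ a b → P a → ¬ Q a → Q b → ¬ P b → r C a b ≡ fzero)
              → ForbidsOn C (λ x → P x ⊎ Q x)
  forbidsOn-∪ {C = C} {P} {Q} irreducible forbidsP forbidsQ P? Q? free i e e-emb inP∪Q
    with any? (λ a → ¬? (P? (e a)))
  ... | no allP = forbidsP i e e-emb (λ a → decidable-stable (P? (e a)) (λ ¬Pa → allP (a , ¬Pa)))
  ... | yes (a₀ , ¬Pa₀) = forbidsQ i e e-emb inQ
    where
      onlyQ : ∀ {x} → P x ⊎ Q x → ¬ P x → Q x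
      onlyQ (inj₁ p) ¬p = ⊥-elim (¬p p)
      onlyQ (inj₂ q) _  = q
      onlyP : ∀ {x} → P x ⊎ Q x → ¬ Q x → P x
      onlyP (inj₁ p) _  = p
      onlyP (inj₂ q) ¬q = ⊥-elim (¬q q)
      Qa₀ : Q (e a₀)
      Qa₀ = onlyQ (inP∪Q a₀) ¬Pa₀
      inQ : ∀ a → Q (e a)
      inQ a with Q? (e a)
      ... | yes Qa = Qa
      ... | no ¬Qa = ⊥-elim (irreducible i a a₀ a≢a₀
                       (trans (sym (preserves-r e-emb a a₀ a≢a₀))
                              (free (e a) (e a₀) (onlyP (inP∪Q a) ¬Qa) ¬Qa Qa₀ ¬Pa₀)))
        where
          a≢a₀ : a ≢ a₀
          a≢a₀ refl = ¬Qa Qa₀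

  ldStructure : ∀ {d m} → (Fin d → Fin ku) → LdStr d m → Structure (Fin m)
  ldStructure ρ B = record { u = ρ ∘ V B ; r = Rd B }

  gluedU : ∀ {d n m} → (Fin d → Fin ku) → Str n → LdStr d m → Fin n ⊎ Fin m → Fin ku
  gluedU ρ I B (inj₁ x) = U I x
  gluedU ρ I B (inj₂ b) = ρ (V B b)

  gluedR : ∀ {d n m} → (Fin d → Fin n → Fin k) → Str n → LdStr d m
         → Fin n ⊎ Fin m → Fin n ⊎ Fin m → Fin k
  gluedR η I B (inj₁ x) (inj₁ y) = R I x y
  gluedR η I B (inj₂ b) (inj₂ c) = Rd B b c
  gluedR η I B (inj₂ b) (inj₁ x) = η (V B b) x
  gluedR η I B (inj₁ x) (inj₂ b) = Flip (η (V B b) x)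

  -- B[γ] for γ = (ρ, η, I), on the carrier I ⊎ B rather than Defs' Fin (n + m).
  glued : ∀ {d n m} → (Fin d → Fin ku) → (Fin d → Fin n → Fin k) → Str n → LdStr d m
        → Structure (Fin n ⊎ Fin m)
  glued ρ η I B = record { u = gluedU ρ I B ; r = gluedR η I B }

  glued-inj₁ : ∀ {d n m} {ρ η} {I : Str n} {B : LdStr d m}
             → IsEmbedding (toStructure I) (glued ρ η I B) inj₁
  glued-inj₁ = isEmbedding inj₁-injective (λ _ → refl) (λ _ _ _ → refl)

  glued-inj₂ : ∀ {d n m} {ρ η} {I : Str n} {B : LdStr d m}
             → IsEmbedding (ldStructure ρ B) (glued ρ η I B) inj₂
  glued-inj₂ = isEmbedding inj₂-injective (λ _ → refl) (λ _ _ _ → refl)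

  glued-wellFormed : ∀ {d n m} {ρ η} {I : Str n} {B : LdStr d m}
                   → WF I → WellFormed (ldStructure ρ B) → WellFormed (glued ρ η I B)
  glued-wellFormed wfI wfB (inj₁ x) (inj₁ y) x≢y = wfI x y (x≢y ∘ cong inj₁)
  glued-wellFormed wfI wfB (inj₂ b) (inj₂ c) b≢c = wfB b c (b≢c ∘ cong inj₂)
  glued-wellFormed wfI wfB (inj₂ b) (inj₁ x) _   = refl
  glued-wellFormed wfI wfB (inj₁ x) (inj₂ b) _   = sym (Flip-involutive _)

  glued-map-isEmbedding : ∀ {d n n′ m} {ρ ρ′ η η′} {I : Str n} {I′ : Str n′} {B : LdStr d m} {f}
                        → IsEmbedding (toStructure I) (toStructure I′) f
                        → (∀ i → ρ′ i ≡ ρ i) → (∀ i x → η′ i (f x) ≡ η i x)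
                        → IsEmbedding (glued ρ η I B) (glued ρ′ η′ I′ B) (map⊎ f id)
  glued-map-isEmbedding {ρ = ρ} {ρ′} {η} {η′} {I} {I′} {B} {f}
                        (isEmbedding f-inj f-u f-r) ρ′≡ρ η′≡η =
    isEmbedding map-inj map-u map-r
    where
      map-inj : Injective _≡_ _≡_ (map⊎ f id)
      map-inj {inj₁ x} {inj₁ y} e = cong inj₁ (f-inj (inj₁-injective e))
      map-inj {inj₂ b} {inj₂ c} e = cong inj₂ (inj₂-injective e)
      map-inj {inj₁ _} {inj₂ _} ()
      map-inj {inj₂ _} {inj₁ _} ()
      map-u : ∀ a → gluedU ρ′ I′ B (map⊎ f id a) ≡ gluedU ρ I B a
      map-u (inj₁ x) = f-u x
      map-u (inj₂ b) = ρ′≡ρ (V B b)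
      map-r : ∀ a b → a ≢ b → gluedR η′ I′ B (map⊎ f id a) (map⊎ f id b) ≡ gluedR η I B a b
      map-r (inj₁ x) (inj₁ y) x≢y = f-r x y (x≢y ∘ cong inj₁)
      map-r (inj₂ b) (inj₂ c) _   = refl
      map-r (inj₂ b) (inj₁ x) _   = η′≡η (V B b) x
      map-r (inj₁ x) (inj₂ b) _   = cong Flip (η′≡η (V B b) x)

  module _ {d n m} (ρ : Fin d → Fin ku) (η : Fin d → Fin n → Fin k) (I : Str n) (B : LdStr d m) where

    glue-U : ∀ i → U (glue ρ η I B) i ≡ gluedU ρ I B (splitAt n i)
    glue-U i with splitAt n i
    ... | inj₁ _ = refl
    ... | inj₂ _ = refl

    glue-R : ∀ i j → R (glue ρ η I B) i j ≡ gluedR η I B (splitAt n i) (splitAt n j)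
    glue-R i j with splitAt n i | splitAt n j
    ... | inj₁ _ | inj₁ _ = refl
    ... | inj₂ _ | inj₂ _ = refl
    ... | inj₂ _ | inj₁ _ = refl
    ... | inj₁ _ | inj₂ _ = refl

    join-isEmbedding : IsEmbedding (glued ρ η I B) (toStructure (glue ρ η I B)) (join n m)
    join-isEmbedding = isEmbedding
      (retraction⇒injective (splitAt n) (splitAt-join n m))
      (λ a → trans (glue-U (join n m a)) (cong (gluedU ρ I B) (splitAt-join n m a)))
      (λ a b _ → trans (glue-R (join n m a) (join n m b))
                       (cong₂ (gluedR η I B) (splitAt-join n m a) (splitAt-join n m b)))

    splitAt-isEmbedding : IsEmbedding (toStructure (glue ρ η I B)) (glued ρ η I B) (splitAt n)
    splitAt-isEmbedding = isEmbedding
      (retraction⇒injective (join n m) (join-splitAt n m))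
      (λ i → sym (glue-U i)) (λ i j _ → sym (glue-R i j))

    in𝒦-glue⇔ : In𝒦 (glue ρ η I B) ⇔ In𝒦ˣ (glued ρ η I B)
    in𝒦-glue⇔ = ⇔.trans (in𝒦⇔ (glue ρ η I B))
      (mk⇔ (in𝒦-pullback join-isEmbedding) (in𝒦-pullback splitAt-isEmbedding))

  asLdStr : ∀ {n} → Str n → LdStr n n
  asLdStr J = record { V = id ; Rd = R J }

  -- I ⊔ J with all cross pairs in R₀, encoded as J glued onto I with each point its own colour.
  freeAmalgam : ∀ {n nJ} → Str n → Str nJ → Structure (Fin n ⊎ Fin nJ)
  freeAmalgam I J = glued (U J) (λ _ _ → fzero) I (asLdStr J)

  freeAmalgam-in𝒦 : ∀ {n nJ} {I : Str n} {J : Str nJ} → (∀ i → Irreducible (proj₂ (𝓕 i)))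
                  → In𝒦ˣ (toStructure I) → In𝒦ˣ (toStructure J) → In𝒦ˣ (freeAmalgam I J)
  freeAmalgam-in𝒦 {I = I} {J} irreducible (wfI , freeI) (wfJ , freeJ) =
    glued-wellFormed {ρ = U J} {η = λ _ _ → fzero} wfI wfJ ,
    𝒦Free-from-forbidsOn
      (forbidsOn-∪ irreducible (forbidsOn-image glued-inj₁ freeI) (forbidsOn-image glued-inj₂ freeJ)
                   (image? (≡-dec _≟_ _≟_) inj₁) (image? (≡-dec _≟_ _≟_) inj₂) cross)
      covered
    where
      cross : ∀ a b → Image inj₁ a → ¬ Image inj₂ a → Image inj₂ b → ¬ Image inj₁ b
            → gluedR (λ _ _ → fzero) I (asLdStr J) a b ≡ fzero
      cross _ _ (x , refl) _ (j , refl) _ = Flip-0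
      covered : ∀ a → Image inj₁ a ⊎ Image inj₂ a
      covered (inj₁ x) = inj₁ (x , refl)
      covered (inj₂ j) = inj₂ (j , refl)

  module Limit (irreducible : ∀ i → Irreducible (proj₂ (𝓕 i))) (K : KStr) (K-limit : FraisseLimit K) where

    Kˣ : Structure ℕ
    Kˣ = record { u = UK K ; r = RK K }

    in𝒦⇔embedsK : ∀ {n} (A : Str n) → In𝒦ˣ (toStructure A) ⇔ ∃ (IsEmbedding (toStructure A) Kˣ)
    in𝒦⇔embedsK A = ⇔.trans (⇔.sym (in𝒦⇔ A)) (⇔.trans (proj₁ (proj₂ K-limit) _ A)
      (mk⇔ (λ (f , f-emb) → f , fromTriple f-emb) (λ (f , f-emb) → f , toTriple f-emb)))

    Kˣ-in𝒦 : In𝒦ˣ Kˣ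
    Kˣ-in𝒦 = proj₁ K-limit , λ i F↪K →
      proj₂ (Equivalence.from (in𝒦⇔embedsK (proj₂ (𝓕 i))) F↪K) i
        (id , isEmbedding id (λ _ → refl) (λ _ _ _ → refl))

    toℕ-isEmbedding : ∀ {n} → IsEmbedding (toStructure (initial K n)) Kˣ toℕ
    toℕ-isEmbedding = isEmbedding toℕ-injective (λ _ → refl) (λ _ _ _ → refl)

    initial-in𝒦 : ∀ n → In𝒦ˣ (toStructure (initial K n))
    initial-in𝒦 n = in𝒦-pullback toℕ-isEmbedding Kˣ-in𝒦

    homogeneous : ∀ {n} {A : Str n} {e₁ e₂}
                → IsEmbedding (toStructure A) Kˣ e₁ → IsEmbedding (toStructure A) Kˣ e₂
                → ∃ λ σ → IsEmbedding Kˣ Kˣ σ × (∀ x → σ (e₁ x) ≡ e₂ x)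
    homogeneous {n} {e₁ = e₁} {e₂} (isEmbedding e₁-inj e₁-u e₁-r) (isEmbedding e₂-inj e₂-u e₂-r)
      with proj₂ (proj₂ K-limit) n e₁ e₂ e₁-inj e₂-inj
             (λ x → trans (e₁-u x) (sym (e₂-u x)))
             (λ x y x≢y → trans (e₁-r x y x≢y) (sym (e₂-r x y x≢y)))
    ... | σ , τ , (τσ , _ , σ-u , σ-r) , σe₁≡e₂ =
      σ , isEmbedding (retraction⇒injective τ τσ) σ-u σ-r , σe₁≡e₂

    record EmbeddingOverInitial {n X} (C : Structure (Fin n ⊎ X)) : Set where
      field
        g             : Fin n ⊎ X → ℕ
        g-isEmbedding : IsEmbedding C Kˣ g
        fixesInitial  : ∀ x → g (inj₁ x) ≡ toℕ x

      above : ∀ y → n ≤ g (inj₂ y)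
      above y = ≮⇒≥ λ gy<n →
        inj₁≢inj₂ (injective g-isEmbedding (trans (fixesInitial (fromℕ< gy<n)) (toℕ-fromℕ< gy<n)))
        where
          inj₁≢inj₂ : ∀ {x} → inj₁ x ≢ inj₂ y
          inj₁≢inj₂ ()

    -- Embed into K, then use ultrahomogeneity to move the copy of K ∩ n back onto n.
    embedOverInitial : ∀ {d n m} {ρ η} {B : LdStr d m}
                     → In𝒦ˣ (glued ρ η (initial K n) B) → EmbeddingOverInitial (glued ρ η (initial K n) B)
    embedOverInitial {n = n} {ρ = ρ} {η} {B} C∈𝒦 = record
      { g = proj₁ moved ∘ proj₁ C↪K
      ; g-isEmbedding = ∘-isEmbedding (proj₁ (proj₂ moved)) (proj₂ C↪K)
      ; fixesInitial = proj₂ (proj₂ moved)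
      }
      where
        glue↪K : ∃ (IsEmbedding (toStructure (glue ρ η (initial K n) B)) Kˣ)
        glue↪K = Equivalence.to (in𝒦⇔embedsK (glue ρ η (initial K n) B))
                   (in𝒦-pullback (splitAt-isEmbedding ρ η (initial K n) B) C∈𝒦)
        C↪K : ∃ (IsEmbedding (glued ρ η (initial K n) B) Kˣ)
        C↪K = proj₁ glue↪K ∘ join n _ ,
              ∘-isEmbedding (proj₂ glue↪K) (join-isEmbedding ρ η (initial K n) B)
        moved : ∃ λ σ → IsEmbedding Kˣ Kˣ σ × (∀ x → σ (proj₁ C↪K (inj₁ x)) ≡ toℕ x)
        moved = homogeneous (∘-isEmbedding (proj₂ C↪K) glued-inj₁) toℕ-isEmbedding

    nodesGlued : ∀ {d n m} → (Fin d → Node n) → LdStr d m → Structure (Fin n ⊎ Fin m)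
    nodesGlued S = glued (λ i → nu (S i)) (λ i → nb (S i)) (initial K _)

    singleton : ∀ {d} → Fin d → LdStr d 1
    singleton i = record { V = λ _ → i ; Rd = λ _ _ → fzero }

    inCT⇔in𝒦 : ∀ {d n} (S : Fin d → Node n) i → InCT K (S i) ⇔ In𝒦ˣ (nodesGlued S (singleton i))
    inCT⇔in𝒦 {n = n} S i = mk⇔ realisedBy realises
      where
        realisedBy : InCT K (S i) → In𝒦ˣ (nodesGlued S (singleton i))
        realisedBy (a , n≤a , a-u , a-r) = in𝒦-pullback (isEmbedding ι-inj ι-u ι-r) Kˣ-in𝒦
          where
            ι : Fin n ⊎ Fin 1 → ℕ
            ι (inj₁ x) = toℕ x
            ι (inj₂ _) = a
            x≢a : ∀ (x : Fin n) → toℕ x ≢ a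
            x≢a x = <⇒≢ (<-≤-trans (toℕ<n x) n≤a)
            ι-inj : Injective _≡_ _≡_ ι
            ι-inj {inj₁ x}      {inj₁ y}      e = cong inj₁ (toℕ-injective e)
            ι-inj {inj₁ x}      {inj₂ _}      e = ⊥-elim (x≢a x e)
            ι-inj {inj₂ _}      {inj₁ y}      e = ⊥-elim (x≢a y (sym e))
            ι-inj {inj₂ fzero}  {inj₂ fzero}  _ = refl
            ι-u : ∀ c → UK K (ι c) ≡ u (nodesGlued S (singleton i)) c
            ι-u (inj₁ x) = refl
            ι-u (inj₂ _) = a-u
            ι-r : ∀ c c′ → c ≢ c′ → RK K (ι c) (ι c′) ≡ r (nodesGlued S (singleton i)) c c′
            ι-r (inj₁ x)     (inj₁ y)     _   = refl
            ι-r (inj₂ _)     (inj₁ x)     _   = a-r x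
            ι-r (inj₁ x)     (inj₂ _)     _   =
              trans (proj₁ K-limit a (toℕ x) (x≢a x ∘ sym)) (cong Flip (a-r x))
            ι-r (inj₂ fzero) (inj₂ fzero) c≢c = ⊥-elim (c≢c refl)
        realises : In𝒦ˣ (nodesGlued S (singleton i)) → InCT K (S i)
        realises C∈𝒦 = g (inj₂ fzero) , above fzero , preserves-u g-isEmbedding (inj₂ fzero) ,
          λ x → trans (cong (RK K (g (inj₂ fzero))) (sym (fixesInitial x)))
                      (preserves-r g-isEmbedding (inj₂ fzero) (inj₁ x) λ ())
          where open EmbeddingOverInitial (embedOverInitial C∈𝒦)

    record FreeCopy {nJ} (n : ℕ) (J : Str nJ) : Set where
      field
        h             : Fin nJ → ℕ
        h-isEmbedding : IsEmbedding (toStructure J) Kˣ h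
        above         : ∀ j → n ≤ h j
        free          : ∀ (x : Fin n) j → RK K (toℕ x) (h j) ≡ fzero

    freeCopy : ∀ {nJ} n {J : Str nJ} → In𝒦 J → FreeCopy n J
    freeCopy n {J} J∈𝒦 = record
      { h = g ∘ inj₂
      ; h-isEmbedding = ∘-isEmbedding g-isEmbedding glued-inj₂
      ; above = above
      ; free = λ x j → trans (cong (λ y → RK K y (g (inj₂ j))) (sym (fixesInitial x)))
                             (trans (preserves-r g-isEmbedding (inj₁ x) (inj₂ j) λ ()) Flip-0)
      }
      where
        open EmbeddingOverInitial
          (embedOverInitial
            (freeAmalgam-in𝒦 irreducible (initial-in𝒦 n) (Equivalence.to (in𝒦⇔ J) J∈𝒦)))

    module Extension {d n nJ} (S : Fin d → Node n) (ρ : Fin d → Fin ku) (η : Fin d → Fin nJ → Fin k)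
                     {J : Str nJ} (copy : FreeCopy n J) (S-sort : ∀ i → nu (S i) ≡ ρ i) where
      open FreeCopy copy

      N : ℕ
      N = suc (max n (map h (allFin nJ)))

      n≤N : n ≤ N
      n≤N = m≤n⇒m≤1+n (⊥≤max n (map h (allFin nJ)))

      h<N : ∀ j → h j < N
      h<N j = s≤s (All.lookup (xs≤max n (map h (allFin nJ))) (∈-map⁺ h (∈-allFin j)))

      h-injective : Injective _≡_ _≡_ h
      h-injective = injective h-isEmbedding

      extension : Fin d → ℕ → Fin k
      extension i p with p <? n
      ... | yes p<n = nb (S i) (fromℕ< p<n)
      ... | no _ with any? (λ j → h j ≟ℕ p)
      ...   | yes (j , _) = η i j
      ...   | no _        = fzero

      extension-initial : ∀ i x → extension i (toℕ x) ≡ nb (S i) x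
      extension-initial i x with toℕ x <? n
      ... | yes x<n = cong (nb (S i)) (toℕ-injective (toℕ-fromℕ< x<n))
      ... | no x≮n  = ⊥-elim (x≮n (toℕ<n x))

      extension-copy : ∀ i j → extension i (h j) ≡ η i j
      extension-copy i j with h j <? n
      ... | yes hj<n = ⊥-elim (<⇒≢ (<-≤-trans hj<n (above j)) refl)
      ... | no _ with any? (λ j′ → h j′ ≟ℕ h j)
      ...   | yes (j′ , hj′≡hj) = cong (η i) (h-injective hj′≡hj)
      ...   | no ¬copy          = ⊥-elim (¬copy (j , refl))

      extension-elsewhere : ∀ i p → ¬ p < n → (∀ j → h j ≢ p) → extension i p ≡ fzero
      extension-elsewhere i p p≮n p∉h with p <? n
      ... | yes p<n = ⊥-elim (p≮n p<n)
      ... | no _ with any? (λ j → h j ≟ℕ p)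
      ...   | yes (j , hj≡p) = ⊥-elim (p∉h j hj≡p)
      ...   | no _           = refl

      S′ : Fin d → Node N
      S′ i = record { nu = nu (S i) ; nb = extension i ∘ toℕ }

      lift : Fin n → Fin N
      lift x = inject≤ x n≤N

      place : Fin nJ → Fin N
      place j = fromℕ< (h<N j)

      extension-lift : ∀ i x → extension i (toℕ (lift x)) ≡ nb (S i) x
      extension-lift i x = trans (cong (extension i) (toℕ-inject≤ x n≤N)) (extension-initial i x)

      lift-isEmbedding : IsEmbedding (toStructure (initial K n)) (toStructure (initial K N)) lift
      lift-isEmbedding = isEmbedding
        (λ e → toℕ-injective (trans (sym (toℕ-inject≤ _ n≤N)) (trans (cong toℕ e) (toℕ-inject≤ _ n≤N))))
        (λ x → cong (UK K) (toℕ-inject≤ x n≤N))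
        (λ x y _ → cong₂ (RK K) (toℕ-inject≤ x n≤N) (toℕ-inject≤ y n≤N))

      place-isEmbedding : IsEmbedding (toStructure J) (toStructure (initial K N)) place
      place-isEmbedding = isEmbedding
        (λ e → h-injective (trans (sym (toℕ-fromℕ< (h<N _))) (trans (cong toℕ e) (toℕ-fromℕ< (h<N _)))))
        (λ j → trans (cong (UK K) (toℕ-fromℕ< (h<N j))) (preserves-u h-isEmbedding j))
        (λ i j i≢j → trans (cong₂ (RK K) (toℕ-fromℕ< (h<N i)) (toℕ-fromℕ< (h<N j)))
                           (preserves-r h-isEmbedding i j i≢j))

      module _ {m} (B : LdStr d m) where

        oldPart : Fin n ⊎ Fin m → Fin N ⊎ Fin m
        oldPart = map⊎ lift id

        gluingPart : Fin nJ ⊎ Fin m → Fin N ⊎ Fin m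
        gluingPart = map⊎ place id

        oldPart-isEmbedding : IsEmbedding (nodesGlued S B) (nodesGlued S′ B) oldPart
        oldPart-isEmbedding = glued-map-isEmbedding lift-isEmbedding (λ _ → refl) extension-lift

        gluingPart-isEmbedding : IsEmbedding (glued ρ η J B) (nodesGlued S′ B) gluingPart
        gluingPart-isEmbedding = glued-map-isEmbedding place-isEmbedding S-sort
          λ i j → trans (cong (extension i) (toℕ-fromℕ< (h<N j))) (extension-copy i j)

        old-gluing-free : ∀ a b → Image oldPart a → ¬ Image gluingPart a
                        → Image gluingPart b → ¬ Image oldPart b
                        → r (nodesGlued S′ B) a b ≡ fzero
        old-gluing-free _ _ (inj₁ x , refl) _ (inj₁ j , refl) _ =
          trans (cong₂ (RK K) (toℕ-inject≤ x n≤N) (toℕ-fromℕ< (h<N j))) (free x j)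
        old-gluing-free _ _ (inj₂ c , refl) ¬glue _ _ = ⊥-elim (¬glue (inj₂ c , refl))
        old-gluing-free _ _ _ _ (inj₂ c , refl) ¬old = ⊥-elim (¬old (inj₂ c , refl))

        initial-rest-free : ∀ a b → Image inj₁ a → ¬ (Image oldPart a ⊎ Image gluingPart a)
                          → Image oldPart b ⊎ Image gluingPart b → ¬ Image inj₁ b
                          → r (nodesGlued S′ B) a b ≡ fzero
        initial-rest-free _ (inj₁ y) _ _ _ ¬initial = ⊥-elim (¬initial (y , refl))
        initial-rest-free _ (inj₂ c) (x , refl) outside _ _ =
          trans (cong Flip (extension-elsewhere (V B c) (toℕ x) x≮n x∉h)) Flip-0
          where
            x≮n : ¬ toℕ x < n
            x≮n x<n = outside (inj₁ (inj₁ (fromℕ< x<n) ,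
              cong inj₁ (toℕ-injective (trans (toℕ-inject≤ _ n≤N) (toℕ-fromℕ< x<n)))))
            x∉h : ∀ j → h j ≢ toℕ x
            x∉h j hj≡x = outside (inj₂ (inj₁ j ,
              cong inj₁ (toℕ-injective (trans (toℕ-fromℕ< (h<N j)) hj≡x))))

        amalgam-in𝒦 : In𝒦ˣ (nodesGlued S B) → In𝒦ˣ (glued ρ η J B) → In𝒦ˣ (nodesGlued S′ B)
        amalgam-in𝒦 (wfOld , freeOld) (_ , freeGluing) =
          glued-wellFormed {ρ = λ i → nu (S i)} {η = λ i → nb (S′ i)} (proj₁ (initial-in𝒦 N)) wfB ,
          𝒦Free-from-forbidsOn forbidsAll covered
          where
            C : Structure (Fin N ⊎ Fin m)
            C = nodesGlued S′ B
            decEq : DecidableEquality (Fin N ⊎ Fin m)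
            decEq = ≡-dec _≟_ _≟_
            wfB : WellFormed (ldStructure (λ i → nu (S i)) B)
            wfB = wellFormed-pullback
                    (glued-inj₂ {ρ = λ i → nu (S i)} {η = λ i → nb (S i)} {I = initial K n}) wfOld
            forbidsInitial : ForbidsOn C (Image inj₁)
            forbidsInitial = forbidsOn-image {C = C} glued-inj₁ (proj₂ (initial-in𝒦 N))
            forbidsOld : ForbidsOn C (Image oldPart)
            forbidsOld = forbidsOn-image {C = C} oldPart-isEmbedding freeOld
            forbidsGluing : ForbidsOn C (Image gluingPart)
            forbidsGluing = forbidsOn-image {C = C} gluingPart-isEmbedding freeGluing
            forbidsOldOrGluing : ForbidsOn C (λ c → Image oldPart c ⊎ Image gluingPart c)
            forbidsOldOrGluing = forbidsOn-∪ {C = C} irreducible forbidsOld forbidsGluing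
              (image⊎? decEq oldPart) (image⊎? decEq gluingPart) old-gluing-free
            forbidsAll : ForbidsOn C (λ c → Image inj₁ c ⊎ (Image oldPart c ⊎ Image gluingPart c))
            forbidsAll = forbidsOn-∪ {C = C} irreducible forbidsInitial forbidsOldOrGluing
              (image? decEq inj₁) (λ c → image⊎? decEq oldPart c ⊎-dec image⊎? decEq gluingPart c)
              initial-rest-free
            covered : ∀ c → Image inj₁ c ⊎ (Image oldPart c ⊎ Image gluingPart c)
            covered (inj₁ y) = inj₁ (y , refl)
            covered (inj₂ c) = inj₂ (inj₁ (inj₂ c , refl))

        in𝒦-extension⇔ : In𝒦ˣ (nodesGlued S′ B) ⇔ (In𝒦ˣ (nodesGlued S B) × In𝒦ˣ (glued ρ η J B))
        in𝒦-extension⇔ = mk⇔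
          (λ C∈𝒦 → in𝒦-pullback oldPart-isEmbedding C∈𝒦 , in𝒦-pullback gluingPart-isEmbedding C∈𝒦)
          (λ (old∈𝒦 , gluing∈𝒦) → amalgam-in𝒦 old∈𝒦 gluing∈𝒦)

      extension-age : (𝒜 : Cls d) → (∀ m B → 𝒜 m B ⇔ AgeS K S m B)
                    → ∀ m B → (𝒜 ∩ Age ρ η J) m B ⇔ AgeS K S′ m B
      extension-age 𝒜 𝒜≡S m B =
        ⇔.trans (𝒜≡S m B ×-⇔ ⇔.refl)
          (⇔.trans (in𝒦-glue⇔ _ _ _ B ×-⇔ in𝒦-glue⇔ ρ η J B)
            (⇔.trans (⇔.sym (in𝒦-extension⇔ B)) (⇔.sym (in𝒦-glue⇔ _ _ _ B))))

      extension-inCT : Reasonable ρ η J → ∀ i → InCT K (S i) → InCT K (S′ i)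
      extension-inCT reasonable i Si∈CT =
        Equivalence.from (inCT⇔in𝒦 S′ i)
          (Equivalence.from (in𝒦-extension⇔ (singleton i))
            (Equivalence.to (inCT⇔in𝒦 S i) Si∈CT ,
             Equivalence.to (in𝒦-glue⇔ ρ η J (singleton i)) (reasonable (singleton i))))

      extension-<lex : ∀ i j → S i <lex S j → S′ i <lex S′ j
      extension-<lex i j (inj₁ nu<nu) = inj₁ nu<nu
      extension-<lex i j (inj₂ (nu≡nu , x , agree , differ)) = inj₂ (nu≡nu , lift x , agree′ , differ′)
        where
          differ′ : nb (S′ i) (lift x) <ᶠ nb (S′ j) (lift x)
          differ′ = subst₂ _<ᶠ_ (sym (extension-lift i x)) (sym (extension-lift j x)) differ
          agree′ : ∀ y → y <ᶠ lift x → nb (S′ i) y ≡ nb (S′ j) y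
          agree′ y y<x = begin
            extension i (toℕ y)     ≡⟨ cong (extension i) y≡ ⟨
            extension i (toℕ y′)    ≡⟨ extension-initial i y′ ⟩
            nb (S i) y′             ≡⟨ agree y′ y′<x ⟩
            nb (S j) y′             ≡⟨ extension-initial j y′ ⟨
            extension j (toℕ y′)    ≡⟨ cong (extension j) y≡ ⟩
            extension j (toℕ y)     ∎
            where
              open ≡-Reasoning
              y<ℕx : toℕ y < toℕ x
              y<ℕx = subst₂ _<_ refl (toℕ-inject≤ x n≤N) y<x
              y′ : Fin n
              y′ = fromℕ< (<-≤-trans y<ℕx (<⇒≤ (toℕ<n x)))
              y≡ : toℕ y′ ≡ toℕ y
              y≡ = toℕ-fromℕ< _
              y′<x : y′ <ᶠ x
              y′<x = subst₂ _<_ (sym y≡) refl y<ℕx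

proposition4p10 :
    (ku k₀ : ℕ) (Flip : Fin (suc k₀) → Fin (suc k₀))
      → Flip fzero ≡ fzero → (∀ i → Flip (Flip i) ≡ i)
      → let open Lang ku k₀ Flip in
        (nF : ℕ) (𝓕 : Fin nF → Σ ℕ Str)
      → let open Forb nF 𝓕 in
        ForbHyps → NonDegenerate
      → (K : KStr) → FraisseLimit K
      → (d : ℕ) (ρ : Fin d → Fin ku) (𝒜 : Cls d) → InP K ρ 𝒜
      → (n : ℕ) (η : Fin d → Fin n → Fin k) (J : Str n) → In𝒦 J
      → Reasonable ρ η J
      → InP K ρ (𝒜 ∩ Age ρ η J)
-- Non-degeneracy of the unaries is a standing assumption of the paper, not needed here.
proposition4p10 ku k₀ Flip Flip-0 Flip-involutive nF 𝓕 hyps _ K K-limit d ρ 𝒜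
                (n , S , S∈CT , S-sorted , S-sort , 𝒜≡S) _ η J J∈𝒦 reasonable =
  N , S′ , (λ i → extension-inCT reasonable i (S∈CT i)) ,
  (λ i j i<j → extension-<lex i j (S-sorted i j i<j)) , S-sort , extension-age 𝒜 𝒜≡S
  where
    open Lang ku k₀ Flip using (Irreducible)
    open Development ku k₀ Flip Flip-0 Flip-involutive nF 𝓕
    irreducible : ∀ i → Irreducible (proj₂ (𝓕 i))
    irreducible i = proj₁ (proj₂ (proj₁ hyps i))
    open Limit irreducible K K-limit
    open Extension S ρ η (freeCopy n {J} J∈𝒦) S-sort
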